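{- Let $U\subseteq \mathbb Z$ and let $U=\bigcup_{\alpha} U_{\alpha}$ be a covering of $U$ by subsets $U_\alpha$ such that for every pair of indices $\alpha_1,\alpha_2$ (not necessarily distinct) and any distinct elements $a_1\in U_{\alpha_1}$, $a_2\in U_{\alpha_2}$, the intersection $U_{\alpha_1}\cap U_{\alpha_2}$ contains infinitely many terms of the arithmetic progression $a_1+(a_2-a_1)\mathbb Z$. Let $f\colon U\to\mathbb Z$. Then $f$ is LIP on $U$ if and only if for every $\alpha$ the restriction of $f$ to $U_\alpha$ is LIP on $U_\alpha$.
   Context: For a subset $S\subseteq\mathbb Z$, a function $g\colon S\to\mathbb Z$ is called LIP (locally integer polynomial) on $S$ if for every finite subset $X\subseteq S$ there is a polynomial $p\in\mathbb Z[x]$ with $p(x)=g(x)$ for all $x\in X$. -}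

module Defs where

open import Data.Integer using (ℤ; _+_; _*_; _-_; +_)
open import Data.List using (List; []; _∷_)
open import Data.List.Relation.Unary.All using (All)
open import Data.List.Membership.Propositional using (_∉_)
open import Data.Product using (Σ; ∃; _×_)
open import Relation.Binary.PropositionalEquality using (_≡_)

Subset : Set₁
Subset = ℤ → Set

-- polynomials in ℤ[x] as coefficient lists (constant term first)
Poly : Set
Poly = List ℤ

eval : Poly → ℤ → ℤ
eval []       x = + 0
eval (c ∷ cs) x = c + x * eval cs x

LIP : Subset → (ℤ → ℤ) → Set
LIP S g = (X : List ℤ) → All S X → ∃ λ (p : Poly) → All (λ x → eval p x ≡ g x) X

Infinite : Subset → Set
Infinite P = (xs : List ℤ) → ∃ λ x → P x × x ∉ xs

InAP : ℤ → ℤ → Subset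
InAP a d x = ∃ λ (k : ℤ) → x ≡ a + d * k

-- If p₁ interpolates f on {a, c} ∪ Z and p₂ on {b, c} ∪ Z, with c ∉ Z on the progression
-- a + (b - a)ℤ, then p₁ - p₂ is divisible by (x - c) ∏_{z ∈ Z} (x - z); as b - c is a multiple
-- of b - a, subtracting a suitable multiple of (x - a) ∏_{z ∈ Z} (x - z) from p₁ interpolates
-- f on {a, b} ∪ Z. The hypothesis provides such c in U_α ∩ U_β outside any finite set, so a
-- finite subset of U_α ∪ U_β can be reduced, one point at a time, to finite subsets of a
-- single U_α or U_β; induction on the number of pieces handles any finite subset of U.

module Submission where

open import Defs
open import Data.Empty using (⊥-elim)
open import Data.Integer using (ℤ; _+_; _*_; _-_; 0ℤ; 1ℤ; -1ℤ)
open import Data.Integer.Properties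
  using (_≟_; +-identityˡ; *-identityˡ; *-zeroʳ; *-assoc; i*j≡0⇒i≡0∨j≡0; i-j≡0⇒i≡j; i≡j⇒i-j≡0)
open import Data.Integer.Tactic.RingSolver using (solve-∀)
open import Data.List using (List; []; _∷_; _++_; map; deduplicate)
open import Data.List.Properties using (++-assoc; ++-identityʳ)
open import Data.List.Membership.Propositional using (_∈_; _∉_)
open import Data.List.Membership.Propositional.Properties using (∈-deduplicate⁻; ∈-deduplicate⁺)
open import Data.List.Relation.Binary.Permutation.Propositional using (_↭_; prep; ↭-sym; ↭-trans)
open import Data.List.Relation.Binary.Permutation.Propositional.Properties using (All-resp-↭; shift; ++⁺ˡ)
open import Data.List.Relation.Unary.All as All using (All; []; _∷_)
open import Data.List.Relation.Unary.All.Properties using (++⁺)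
open import Data.List.Relation.Unary.AllPairs using ([]; _∷_)
open import Data.List.Relation.Unary.Any using (here; there)
open import Data.List.Relation.Unary.Unique.Propositional using (Unique)
open import Data.List.Relation.Unary.Unique.DecPropositional.Properties using (deduplicate-!)
open import Data.Product using (∃; _×_; _,_; proj₁; proj₂)
open import Data.Sum using (inj₁; inj₂)
open import Function.Bundles using (_⇔_; mk⇔; Equivalence)
open import Relation.Binary.PropositionalEquality using (_≡_; _≢_; refl; sym; trans; cong; subst; module ≡-Reasoning)
open import Relation.Nullary using (yes; no)

open ≡-Reasoning

infixl 6 _+ₚ_ _-ₚ_
infixr 7 _·ₚ_

_+ₚ_ : Poly → Poly → Poly
[]      +ₚ q       = q
(a ∷ p) +ₚ []      = a ∷ p
(a ∷ p) +ₚ (b ∷ q) = a + b ∷ p +ₚ q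

_·ₚ_ : ℤ → Poly → Poly
k ·ₚ p = map (k *_) p

_-ₚ_ : Poly → Poly → Poly
p -ₚ q = p +ₚ -1ℤ ·ₚ q

eval-+ₚ : ∀ p q x → eval (p +ₚ q) x ≡ eval p x + eval q x
eval-+ₚ []      q       x = sym (+-identityˡ (eval q x))
eval-+ₚ (a ∷ p) []      x = ring (a + x * eval p x)
  where ring : ∀ u → u ≡ u + 0ℤ
        ring = solve-∀
eval-+ₚ (a ∷ p) (b ∷ q) x = begin
  a + b + x * eval (p +ₚ q) x        ≡⟨ cong (λ v → a + b + x * v) (eval-+ₚ p q x) ⟩
  a + b + x * (eval p x + eval q x)  ≡⟨ ring a b x (eval p x) (eval q x) ⟩
  a + x * eval p x + (b + x * eval q x) ∎
  where ring : ∀ a b x u v → a + b + x * (u + v) ≡ a + x * u + (b + x * v)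
        ring = solve-∀

eval-·ₚ : ∀ k p x → eval (k ·ₚ p) x ≡ k * eval p x
eval-·ₚ k []      x = ring k
  where ring : ∀ k → 0ℤ ≡ k * 0ℤ
        ring = solve-∀
eval-·ₚ k (a ∷ p) x = begin
  k * a + x * eval (k ·ₚ p) x  ≡⟨ cong (λ v → k * a + x * v) (eval-·ₚ k p x) ⟩
  k * a + x * (k * eval p x)   ≡⟨ ring k a x (eval p x) ⟩
  k * (a + x * eval p x)       ∎
  where ring : ∀ k a x u → k * a + x * (k * u) ≡ k * (a + x * u)
        ring = solve-∀

eval-subₚ : ∀ p q x → eval (p -ₚ q) x ≡ eval p x - eval q x
eval-subₚ p q x = begin
  eval (p +ₚ -1ℤ ·ₚ q) x        ≡⟨ eval-+ₚ p (-1ℤ ·ₚ q) x ⟩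
  eval p x + eval (-1ℤ ·ₚ q) x  ≡⟨ cong (eval p x +_) (eval-·ₚ -1ℤ q x) ⟩
  eval p x + -1ℤ * eval q x     ≡⟨ ring (eval p x) (eval q x) ⟩
  eval p x - eval q x           ∎
  where ring : ∀ u v → u + -1ℤ * v ≡ u - v
        ring = solve-∀

vanishing : List ℤ → Poly
vanishing []      = 1ℤ ∷ []
vanishing (z ∷ Z) = (0ℤ ∷ vanishing Z) -ₚ z ·ₚ vanishing Z

eval-vanishing-[] : ∀ x → eval (vanishing []) x ≡ 1ℤ
eval-vanishing-[] x = ring x
  where ring : ∀ x → 1ℤ + x * 0ℤ ≡ 1ℤ
        ring = solve-∀

eval-vanishing-∷ : ∀ z Z x → eval (vanishing (z ∷ Z)) x ≡ (x - z) * eval (vanishing Z) x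
eval-vanishing-∷ z Z x = begin
  eval ((0ℤ ∷ vanishing Z) -ₚ z ·ₚ vanishing Z) x    ≡⟨ eval-subₚ (0ℤ ∷ vanishing Z) (z ·ₚ vanishing Z) x ⟩
  0ℤ + x * v - eval (z ·ₚ vanishing Z) x             ≡⟨ cong (0ℤ + x * v -_) (eval-·ₚ z (vanishing Z) x) ⟩
  0ℤ + x * v - z * v                                 ≡⟨ ring x z v ⟩
  (x - z) * v                                        ∎
  where
  v = eval (vanishing Z) x
  ring : ∀ x z v → 0ℤ + x * v - z * v ≡ (x - z) * v
  ring = solve-∀

eval-vanishing-∈ : ∀ {z} Z → z ∈ Z → eval (vanishing Z) z ≡ 0ℤ
eval-vanishing-∈ {z} (z ∷ Z) (here refl) = begin
  eval (vanishing (z ∷ Z)) z      ≡⟨ eval-vanishing-∷ z Z z ⟩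
  (z - z) * eval (vanishing Z) z  ≡⟨ ring z (eval (vanishing Z) z) ⟩
  0ℤ                              ∎
  where ring : ∀ z v → (z - z) * v ≡ 0ℤ
        ring = solve-∀
eval-vanishing-∈ {z} (y ∷ Z) (there z∈Z) = begin
  eval (vanishing (y ∷ Z)) z      ≡⟨ eval-vanishing-∷ y Z z ⟩
  (z - y) * eval (vanishing Z) z  ≡⟨ cong ((z - y) *_) (eval-vanishing-∈ Z z∈Z) ⟩
  (z - y) * 0ℤ                    ≡⟨ *-zeroʳ (z - y) ⟩
  0ℤ                              ∎

quotient : ℤ → Poly → Poly
quotient l []       = []
quotient l (c ∷ cs) = eval cs l ∷ quotient l cs

eval-quotient : ∀ l p x → eval p x ≡ eval p l + (x - l) * eval (quotient l p) x
eval-quotient l []       x = ring (x - l)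
  where ring : ∀ u → 0ℤ ≡ 0ℤ + u * 0ℤ
        ring = solve-∀
eval-quotient l (c ∷ cs) x = begin
  c + x * eval cs x                                        ≡⟨ cong (λ v → c + x * v) (eval-quotient l cs x) ⟩
  c + x * (eval cs l + (x - l) * eval (quotient l cs) x)  ≡⟨ ring c x l (eval cs l) (eval (quotient l cs) x) ⟩
  c + l * eval cs l + (x - l) * (eval cs l + x * eval (quotient l cs) x) ∎
  where ring : ∀ c x l r q → c + x * (r + (x - l) * q) ≡ c + l * r + (x - l) * (r + x * q)
        ring = solve-∀

factor-root : ∀ l p → eval p l ≡ 0ℤ → ∀ x → eval p x ≡ (x - l) * eval (quotient l p) x
factor-root l p pl≡0 x = begin
  eval p x                                  ≡⟨ eval-quotient l p x ⟩
  eval p l + (x - l) * eval (quotient l p) x ≡⟨ cong (_+ (x - l) * eval (quotient l p) x) pl≡0 ⟩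
  0ℤ + (x - l) * eval (quotient l p) x      ≡⟨ +-identityˡ _ ⟩
  (x - l) * eval (quotient l p) x           ∎

quotient-root : ∀ {l y} p → l ≢ y → eval p l ≡ 0ℤ → eval p y ≡ 0ℤ → eval (quotient l p) y ≡ 0ℤ
quotient-root {l} {y} p l≢y pl≡0 py≡0
  with i*j≡0⇒i≡0∨j≡0 (y - l) (trans (sym (factor-root l p pl≡0 y)) py≡0)
... | inj₁ y-l≡0 = ⊥-elim (l≢y (sym (i-j≡0⇒i≡j y l y-l≡0)))
... | inj₂ qy≡0  = qy≡0

vanishing-divides : ∀ L → Unique L → ∀ p → All (λ x → eval p x ≡ 0ℤ) L →
                    ∃ λ h → ∀ x → eval p x ≡ eval (vanishing L) x * eval h x
vanishing-divides []      []            p []             = p , λ x → begin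
  eval p x                            ≡⟨ *-identityˡ (eval p x) ⟨
  1ℤ * eval p x                       ≡⟨ cong (_* eval p x) (eval-vanishing-[] x) ⟨
  eval (vanishing []) x * eval p x    ∎
vanishing-divides (l ∷ L) (l∉L ∷ uniq) p (pl≡0 ∷ pL≡0)
  with vanishing-divides L uniq (quotient l p)
         (All.zipWith (λ (l≢y , py≡0) → quotient-root p l≢y pl≡0 py≡0) (l∉L , pL≡0))
... | h , q≡ = h , λ x → begin
  eval p x                                     ≡⟨ factor-root l p pl≡0 x ⟩
  (x - l) * eval (quotient l p) x              ≡⟨ cong ((x - l) *_) (q≡ x) ⟩
  (x - l) * (eval (vanishing L) x * eval h x)  ≡⟨ *-assoc (x - l) _ _ ⟨
  (x - l) * eval (vanishing L) x * eval h x    ≡⟨ cong (_* eval h x) (eval-vanishing-∷ l L x) ⟨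
  eval (vanishing (l ∷ L)) x * eval h x        ∎

Interpolable : (ℤ → ℤ) → List ℤ → Set
Interpolable f X = ∃ λ p → All (λ x → eval p x ≡ f x) X

LIP-mono : ∀ {S T g} → (∀ {x} → S x → T x) → LIP T g → LIP S g
LIP-mono S⊆T lip X Xˢ = lip X (All.map S⊆T Xˢ)

module _ {f : ℤ → ℤ} where

  Interpolable-resp-↭ : ∀ {X Y} → X ↭ Y → Interpolable f X → Interpolable f Y
  Interpolable-resp-↭ X↭Y (p , agree) = p , All-resp-↭ X↭Y agree

  Interpolable-dup : ∀ {x X} → Interpolable f (x ∷ X) → Interpolable f (x ∷ x ∷ X)
  Interpolable-dup (p , px ∷ agree) = p , px ∷ px ∷ agree

  glue : ∀ {a b c} Z → c ∉ Z → InAP a (b - a) c →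
         Interpolable f (a ∷ c ∷ Z) → Interpolable f (b ∷ c ∷ Z) → Interpolable f (a ∷ b ∷ Z)
  glue {a} {b} {c} Z c∉Z (k , c≡) (p₁ , p₁a ∷ p₁c ∷ p₁Z) (p₂ , p₂b ∷ p₂c ∷ p₂Z) =
    p , p-agrees (here refl) p₁a ∷ p-at-b
      ∷ All.tabulate (λ z∈Z → p-agrees (there (∈-deduplicate⁺ _≟_ z∈Z)) (All.lookup p₁Z z∈Z))
    where
    Z′ : List ℤ
    Z′ = deduplicate _≟_ Z

    difference-root : ∀ {x} → eval p₁ x ≡ f x → eval p₂ x ≡ f x → eval (p₁ -ₚ p₂) x ≡ 0ℤ
    difference-root {x} p₁x p₂x = trans (eval-subₚ p₁ p₂ x) (i≡j⇒i-j≡0 (trans p₁x (sym p₂x)))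

    cZ′-unique : Unique (c ∷ Z′)
    cZ′-unique = All.tabulate (λ { y∈Z′ refl → c∉Z (∈-deduplicate⁻ _≟_ Z y∈Z′) }) ∷ deduplicate-! _≟_ Z

    difference-factors : ∃ λ h → ∀ x → eval (p₁ -ₚ p₂) x ≡ eval (vanishing (c ∷ Z′)) x * eval h x
    difference-factors = vanishing-divides (c ∷ Z′) cZ′-unique (p₁ -ₚ p₂)
      (difference-root p₁c p₂c ∷ All.tabulate λ z∈Z′ →
        let z∈Z = ∈-deduplicate⁻ _≟_ Z z∈Z′ in difference-root (All.lookup p₁Z z∈Z) (All.lookup p₂Z z∈Z))

    -- b - c = (1 - k) (b - a), so t (x - a) ∏ (x - z) meets (p₁ - p₂)(x) = (x - c) ∏ (x - z) h(x) at b
    t : ℤ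
    t = (1ℤ - k) * eval (proj₁ difference-factors) b

    p : Poly
    p = p₁ -ₚ t ·ₚ vanishing (a ∷ Z′)

    eval-p : ∀ x → eval p x ≡ eval p₁ x - t * eval (vanishing (a ∷ Z′)) x
    eval-p x = trans (eval-subₚ p₁ _ x) (cong (eval p₁ x -_) (eval-·ₚ t (vanishing (a ∷ Z′)) x))

    p-agrees : ∀ {x} → x ∈ a ∷ Z′ → eval p₁ x ≡ f x → eval p x ≡ f x
    p-agrees {x} x∈aZ′ p₁x = begin
      eval p x                                         ≡⟨ eval-p x ⟩
      eval p₁ x - t * eval (vanishing (a ∷ Z′)) x      ≡⟨ cong (λ v → eval p₁ x - t * v) (eval-vanishing-∈ (a ∷ Z′) x∈aZ′) ⟩
      eval p₁ x - t * 0ℤ                               ≡⟨ ring (eval p₁ x) t ⟩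
      eval p₁ x                                        ≡⟨ p₁x ⟩
      f x                                              ∎
      where ring : ∀ u t → u - t * 0ℤ ≡ u
            ring = solve-∀

    correction-at-b : t * eval (vanishing (a ∷ Z′)) b ≡ eval (p₁ -ₚ p₂) b
    correction-at-b = begin
      t * eval (vanishing (a ∷ Z′)) b        ≡⟨ cong (t *_) (eval-vanishing-∷ a Z′ b) ⟩
      (1ℤ - k) * h * ((b - a) * w)           ≡⟨ ring a b k h w ⟩
      (b - (a + (b - a) * k)) * w * h        ≡⟨ cong (λ c → (b - c) * w * h) c≡ ⟨
      (b - c) * w * h                        ≡⟨ cong (_* h) (eval-vanishing-∷ c Z′ b) ⟨
      eval (vanishing (c ∷ Z′)) b * h        ≡⟨ proj₂ difference-factors b ⟨
      eval (p₁ -ₚ p₂) b                      ∎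
      where
      h = eval (proj₁ difference-factors) b
      w = eval (vanishing Z′) b
      ring : ∀ a b k h w → (1ℤ - k) * h * ((b - a) * w) ≡ (b - (a + (b - a) * k)) * w * h
      ring = solve-∀

    p-at-b : eval p b ≡ f b
    p-at-b = begin
      eval p b                                         ≡⟨ eval-p b ⟩
      eval p₁ b - t * eval (vanishing (a ∷ Z′)) b      ≡⟨ cong (eval p₁ b -_) correction-at-b ⟩
      eval p₁ b - eval (p₁ -ₚ p₂) b                    ≡⟨ cong (eval p₁ b -_) (eval-subₚ p₁ p₂ b) ⟩
      eval p₁ b - (eval p₁ b - eval p₂ b)              ≡⟨ ring (eval p₁ b) (eval p₂ b) ⟩
      eval p₂ b                                        ≡⟨ p₂b ⟩
      f b                                              ∎
      where ring : ∀ u v → u - (u - v) ≡ v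
            ring = solve-∀

shift₂ : ∀ {a} {A : Set a} (v : A) xs ys zs → xs ++ ys ++ v ∷ zs ↭ v ∷ xs ++ ys ++ zs
shift₂ v xs ys zs = ↭-trans (++⁺ˡ xs (shift v ys zs)) (shift v xs (ys ++ zs))

module _ (f : ℤ → ℤ) {I : Set} (V : I → Subset)
  (progression : ∀ α₁ α₂ a₁ a₂ → V α₁ a₁ → V α₂ a₂ → a₁ ≢ a₂
                 → Infinite (λ x → (V α₁ x × V α₂ x) × InAP a₁ (a₂ - a₁) x))
  (local : ∀ α → LIP (V α) f) where

  Common : I → I → List ℤ → Set
  Common α β = All (λ x → V α x × V β x)

  glue-step : ∀ {α β a b} A B D → V α a → V β b →
    (∀ C → Common α β C → Interpolable f (a ∷ A ++ B ++ C ++ D)) →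
    (∀ C → Common α β C → Interpolable f (A ++ b ∷ B ++ C ++ D)) →
    ∀ C → Common α β C → Interpolable f (a ∷ A ++ b ∷ B ++ C ++ D)
  glue-step {a = a} {b} A B D aα bβ without-b without-a C Cαβ with a ≟ b
  ... | yes refl =
    Interpolable-resp-↭ (prep a (↭-sym (shift a A (B ++ C ++ D)))) (Interpolable-dup (without-b C Cαβ))
  ... | no a≢b with progression _ _ a b aα bβ a≢b (a ∷ b ∷ A ++ B ++ C ++ D)
  ... | c , (cαβ , c∈ap) , c∉abZ =
    Interpolable-resp-↭ (prep a (↭-sym (shift b A (B ++ C ++ D))))
      (glue (A ++ B ++ C ++ D) (λ c∈Z → c∉abZ (there (there c∈Z))) c∈ap
        (Interpolable-resp-↭ (prep a (shift₂ c A B (C ++ D))) (without-b (c ∷ C) (cαβ ∷ Cαβ)))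
        (Interpolable-resp-↭ (↭-trans (shift b A _) (prep b (shift₂ c A B (C ++ D))))
          (without-a (c ∷ C) (cαβ ∷ Cαβ))))

  merge : ∀ {α β} D → (∀ γ Y → All (V γ) Y → Interpolable f (Y ++ D)) →
          ∀ A B → All (V α) A → All (V β) B →
          ∀ C → Common α β C → Interpolable f (A ++ B ++ C ++ D)
  merge {β = β} D extendD [] B _ Bβ C Cαβ =
    subst (Interpolable f) (++-assoc B C D) (extendD β (B ++ C) (++⁺ Bβ (All.map proj₂ Cαβ)))
  merge {α} D extendD (a ∷ A) [] Aα _ C Cαβ =
    subst (Interpolable f) (++-assoc (a ∷ A) C D) (extendD α (a ∷ A ++ C) (++⁺ Aα (All.map proj₁ Cαβ)))
  merge D extendD (a ∷ A) (b ∷ B) (aα ∷ Aα) (bβ ∷ Bβ) =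
    glue-step A B D aα bβ (merge D extendD (a ∷ A) B (aα ∷ Aα) Bβ)
                          (merge D extendD A (b ∷ B) Aα (bβ ∷ Bβ))

  Interpolable-++ : ∀ X → All (λ x → ∃ λ α → V α x) X →
                    ∀ α Y → All (V α) Y → Interpolable f (Y ++ X)
  Interpolable-++ []      []               α Y Yα =
    subst (Interpolable f) (sym (++-identityʳ Y)) (local α Y Yα)
  Interpolable-++ (x ∷ X) ((β , xβ) ∷ Xᵛ) α Y Yα =
    merge X (Interpolable-++ X Xᵛ) Y (x ∷ []) Yα (xβ ∷ []) [] []

  LIP-of-cover : ∀ {U} → (∀ {x} → U x → ∃ λ α → V α x) → LIP U f
  LIP-of-cover cover []      []       = [] , []
  LIP-of-cover cover (x ∷ X) (u ∷ Xᵘ) with cover u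
  ... | α , xα = Interpolable-++ X (All.map cover Xᵘ) α (x ∷ []) (xα ∷ [])

theorem9 : (U : Subset) (I : Set) (V : I → Subset)
    → (∀ x → U x ⇔ ∃ λ α → V α x)
    → (∀ α₁ α₂ a₁ a₂ → V α₁ a₁ → V α₂ a₂ → a₁ ≢ a₂
        → Infinite (λ x → (V α₁ x × V α₂ x) × InAP a₁ (a₂ - a₁) x))
    → (f : ℤ → ℤ)
    → LIP U f ⇔ (∀ α → LIP (V α) f)
theorem9 U I V cover progression f = mk⇔
  (λ lip α → LIP-mono (λ {x} xα → Equivalence.from (cover x) (α , xα)) lip)
  (λ local → LIP-of-cover f V progression local (λ {x} → Equivalence.to (cover x)))
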